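{- Let $n\in\mathbb{N}$ and $(a_1,\ldots,a_n)\in\mathcal{A}_n$. Then $$c_{(a_1,\ldots,a_n)}=\prod_{k=1}^{n-1}\frac{n-k+1-\sum_{i=k+1}^{n}a_{i}}{a_{k}!}.$$
   Context: For $n\in\mathbb{N}$ and indeterminates $x_1,\ldots,x_n$, let $p_n=x_1(x_1+x_2)(x_1+x_2+x_3)\cdots(x_1+x_2+\cdots+x_n)$. Let $\mathbb{N}_0=\mathbb{N}\cup\{0\}$ and $\mathcal{A}_n=\{(a_1,\ldots,a_n)\in\mathbb{N}_0^n : \sum_{i=k+1}^n a_i\le n-k \text{ for all } 1\le k\le n-1,\ \sum_{i=1}^n a_i=n\}$. For $(a_1,\ldots,a_n)\in\mathcal{A}_n$, $c_{(a_1,\ldots,a_n)}$ denotes the coefficient of the monomial $x_1^{a_1}\cdots x_n^{a_n}$ in the expansion of $p_n$ (after combining like terms). -}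

module Defs where

open import Data.Nat using (ℕ; zero; suc; _+_; _*_; _∸_; _≤_; _!)
open import Data.Nat.Properties using (_!≢0)
import Data.Nat.Properties as ℕP
open import Data.Fin using (Fin; toℕ)
open import Data.Nat.ListAction using (sum)
open import Data.List using (List; []; _∷_; map; concatMap; foldr; filter; allFin; drop; upTo; _++_)
import Data.List as L
open import Data.Vec using (Vec; replicate; zipWith; toList; tabulate)
open import Data.Vec.Properties using (≡-dec)
open import Data.Product using (_×_; _,_; proj₁; proj₂)
open import Data.Integer using (+_)
open import Data.Rational using (ℚ; _/_)
import Data.Rational as ℚ
open import Relation.Nullary using (does)
open import Relation.Nullary.Decidable using (⌊_⌋)
open import Relation.Binary.PropositionalEquality using (_≡_)
open import Data.Bool using (if_then_else_)

-- A polynomial with natural-number coefficients in the indeterminates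
-- x_1,...,x_n (x_{i+1} represented by index i : Fin n), given as a formal
-- (not yet simplified) sum of terms  coefficient * x^exponent.
Exponent : ℕ → Set
Exponent n = Vec ℕ n

Poly : ℕ → Set
Poly n = List (ℕ × Exponent n)

one : ∀ {n} → Poly n
one = (1 , replicate _ 0) ∷ []

var : ∀ {n} → Fin n → Poly n
var {n} i = (1 , tabulate (λ j → if ⌊ toℕ j ℕP.≟ toℕ i ⌋ then 1 else 0)) ∷ []

_+P_ : ∀ {n} → Poly n → Poly n → Poly n
p +P q = p ++ q

_*P_ : ∀ {n} → Poly n → Poly n → Poly n
p *P q = concatMap (λ t → map (λ s → (proj₁ t * proj₁ s , zipWith _+_ (proj₂ t) (proj₂ s))) q) p

coeff : ∀ {n} → Poly n → Exponent n → ℕ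
coeff p e = sum (map proj₁ (filter (λ t → ≡-dec ℕP._≟_ (proj₂ t) e) p))

partialSum : (n k : ℕ) → Poly n
partialSum n k = foldr (λ i acc → var i +P acc) [] (filter (λ i → toℕ i ℕP.<? k) (allFin n))

-- p_n = x_1 (x_1+x_2) ... (x_1+...+x_n)
pPoly : (n : ℕ) → Poly n
pPoly n = foldr (λ k acc → partialSum n (suc k) *P acc) one (upTo n)

headOr0 : List ℕ → ℕ
headOr0 [] = 0
headOr0 (x ∷ _) = x

-- 1-based access a_k (for 1 ≤ k ≤ n) of a = (a_1,...,a_n)
entry : ∀ {n} → Vec ℕ n → ℕ → ℕ
entry a k = headOr0 (drop (k ∸ 1) (toList a))

tailSum : ∀ {n} → Vec ℕ n → ℕ → ℕ
tailSum a k = sum (drop k (toList a))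

InA : (n : ℕ) → Vec ℕ n → Set
InA n a = ((k : ℕ) → 1 ≤ k → k ≤ n ∸ 1 → tailSum a k ≤ n ∸ k)
        × sum (toList a) ≡ n

factor : (n : ℕ) → Vec ℕ n → ℕ → ℚ
factor n a k = _/_ (+ (n ∸ k + 1 ∸ tailSum a k)) (entry a k !) {{entry a k !≢0}}

prodFactors : (n : ℕ) → Vec ℕ n → ℚ
prodFactors n a = foldr (λ k acc → factor n a k ℚ.* acc) ℚ.1ℚ (map suc (upTo (n ∸ 1)))

-- Write u = x₁ + x₂. Then p_n = x₁ · q(u, x₃, …, x_n), where q is p_{n-1} in the variables u, x₃, …, x_n,
-- so by the binomial theorem
--   c_(a₁+1, a₂, a₃, …, a_n) = C(a₁+a₂, a₁) · c_(a₁+a₂, a₃, …, a_n).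
-- The constraints force the first exponent to be positive and pass to the shorter tuple (a₁+a₂, a₃, …, a_n).
-- The product formula obeys the same recursion: its first two factors (a₁+1)/(a₁+1)! · m/a₂! equal
-- C(a₁+a₂, a₁) · m/(a₁+a₂)!, i.e. C(a₁+a₂, a₁) times the first factor for the shorter tuple, and all later
-- factors coincide.

module Submission where

open import Defs
open import Data.Bool using (true; false; if_then_else_)
open import Data.Empty using (⊥-elim)
open import Data.Fin as Fin using (Fin; toℕ)
open import Data.Integer using (+_)
import Data.Integer as ℤ using (_*_)
import Data.Integer.Properties as ℤ
open import Data.List using (List; []; _∷_; _++_; map; filter; foldr; allFin; upTo; applyUpTo)
import Data.List.Properties as List
open import Data.Maybe using (Maybe; just; nothing; maybe)
open import Data.Maybe.Properties using (just-injective)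
open import Data.Nat using (ℕ; zero; suc; _+_; _*_; _∸_; _!; _≤_; _<?_; s≤s; z≤n; NonZero)
open import Data.Nat.Combinatorics using (_C_; nCk+nC[k+1]≡[n+1]C[k+1]; nCn≡1; nCk≡n!/k![n-k]!; k![n∸k]!∣n!)
open import Data.Nat.DivMod using (m/n*n≡m)
open import Data.Nat.ListAction using (sum)
open import Data.Nat.ListAction.Properties using (sum-++)
open import Data.Nat.Properties
  using (_≟_; _!≢0; _!*_!≢0; m*n≢0; +-assoc; +-suc; +-identityʳ; *-identityˡ; *-zeroʳ;
         *-distribˡ-+; *-distribʳ-+; *-commutativeSemigroup; m+n∸m≡n; m+n∸n≡m; suc-injective; m≤m+n; +-comm; 1+n≰n)
open import Data.Nat.Tactic.RingSolver using (solve-∀)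
open import Algebra.Properties.CommutativeSemigroup *-commutativeSemigroup using (x∙yz≈y∙xz)
open import Data.Product using (_×_; _,_; proj₁; proj₂)
open import Data.Rational using (ℚ; _/_)
import Data.Rational as ℚ
import Data.Rational.Properties as ℚ
import Data.Rational.Unnormalised as ℚᵘ
import Data.Rational.Unnormalised.Properties as ℚᵘ
open import Data.Vec using (Vec; []; _∷_; zipWith; tabulate; replicate; toList)
open import Data.Vec.Properties using (≡-dec; tabulate-cong)
open import Function using (_∘_; _$_; case_of_)
open import Relation.Nullary using (does; ¬_; yes; no)
open import Relation.Nullary.Decidable using (⌊_⌋; isYes≗does; dec-true; dec-false)
open import Relation.Binary.PropositionalEquality
open ≡-Reasoning

private
  variable
    n : ℕ

_∸?_ : ℕ → ℕ → Maybe ℕ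
m ∸? zero = just m
zero ∸? suc k = nothing
suc m ∸? suc k = m ∸? k

∸?-sound : ∀ {m k d} → m ∸? k ≡ just d → k + d ≡ m
∸?-sound {k = zero} refl = refl
∸?-sound {zero} {suc k} ()
∸?-sound {suc m} {suc k} eq = cong suc (∸?-sound eq)

∸?-complete : ∀ k d → (k + d) ∸? k ≡ just d
∸?-complete zero d = refl
∸?-complete (suc k) d = ∸?-complete k d

_∷?_ : Maybe ℕ → Maybe (Vec ℕ n) → Maybe (Vec ℕ (suc n))
just d ∷? just w = just (d ∷ w)
_ ∷? _ = nothing

∷?-inverse : ∀ {a} {b : Maybe (Vec ℕ n)} {d w} → a ∷? b ≡ just (d ∷ w) → a ≡ just d × b ≡ just w
∷?-inverse {a = just _} {just _} refl = refl , refl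

_∸ᵛ?_ : Vec ℕ n → Vec ℕ n → Maybe (Vec ℕ n)
[] ∸ᵛ? [] = just []
(m ∷ e) ∸ᵛ? (k ∷ v) = (m ∸? k) ∷? (e ∸ᵛ? v)

∸ᵛ?-sound : ∀ {e v w : Vec ℕ n} → e ∸ᵛ? v ≡ just w → zipWith _+_ v w ≡ e
∸ᵛ?-sound {e = []} {[]} {[]} refl = refl
∸ᵛ?-sound {e = _ ∷ _} {_ ∷ _} {_ ∷ _} eq =
  let head , tail = ∷?-inverse eq in cong₂ _∷_ (∸?-sound head) (∸ᵛ?-sound tail)

∸ᵛ?-complete : ∀ {e v w : Vec ℕ n} → zipWith _+_ v w ≡ e → e ∸ᵛ? v ≡ just w
∸ᵛ?-complete {v = []} {[]} refl = refl
∸ᵛ?-complete {v = k ∷ v} {d ∷ w} refl rewrite ∸?-complete k d | ∸ᵛ?-complete {v = v} {w} refl = refl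

∸ᵛ?-zeros : ∀ (e : Vec ℕ n) → e ∸ᵛ? tabulate (λ _ → 0) ≡ just e
∸ᵛ?-zeros [] = refl
∸ᵛ?-zeros (m ∷ e) rewrite ∸ᵛ?-zeros e = refl

Term : ℕ → Set
Term n = ℕ × Exponent n

termCoeff : Term n → Exponent n → ℕ
termCoeff (c , w) e = if does (≡-dec _≟_ w e) then c else 0

termCoeff-≡ : ∀ c {w e : Exponent n} → w ≡ e → termCoeff (c , w) e ≡ c
termCoeff-≡ c {w} {e} w≡e rewrite dec-true (≡-dec _≟_ w e) w≡e = refl

termCoeff-≢ : ∀ c {w e : Exponent n} → ¬ w ≡ e → termCoeff (c , w) e ≡ 0
termCoeff-≢ c {w} {e} w≢e rewrite dec-false (≡-dec _≟_ w e) w≢e = refl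

coeff-∷ : ∀ (t : Term n) p e → coeff (t ∷ p) e ≡ termCoeff t e + coeff p e
coeff-∷ (c , w) p e with does (≡-dec _≟_ w e)
... | true = refl
... | false = refl

coeff-++ : ∀ (p q : Poly n) e → coeff (p ++ q) e ≡ coeff p e + coeff q e
coeff-++ p q e = begin
  sum (map proj₁ (filter P? (p ++ q)))
    ≡⟨ cong (sum ∘ map proj₁) (List.filter-++ P? p q) ⟩
  sum (map proj₁ (filter P? p ++ filter P? q))
    ≡⟨ cong sum (List.map-++ proj₁ (filter P? p) (filter P? q)) ⟩
  sum (map proj₁ (filter P? p) ++ map proj₁ (filter P? q))
    ≡⟨ sum-++ (map proj₁ (filter P? p)) (map proj₁ (filter P? q)) ⟩
  coeff p e + coeff q e ∎
  where P? = λ (t : Term _) → ≡-dec _≟_ (proj₂ t) e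

_·ᵗ_ : Term n → Term n → Term n
t ·ᵗ s = proj₁ t * proj₁ s , zipWith _+_ (proj₂ t) (proj₂ s)

-- t ⊙ g and p ⊛ g are the coefficient functions of t · G and p · G, for any G with coefficient function g;
-- working with g rather than G lets the variables be peeled off one at a time.
_⊙_ : Term n → (Exponent n → ℕ) → Exponent n → ℕ
((c , v) ⊙ g) e = maybe (λ w → c * g w) 0 (e ∸ᵛ? v)

_⊛_ : Poly n → (Exponent n → ℕ) → Exponent n → ℕ
([] ⊛ g) e = 0
((t ∷ p) ⊛ g) e = (t ⊙ g) e + (p ⊛ g) e

⊙-cong : ∀ (t : Term n) {g h} → (∀ e → g e ≡ h e) → ∀ e → (t ⊙ g) e ≡ (t ⊙ h) e
⊙-cong (c , v) g≗h e with e ∸ᵛ? v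
... | just w = cong (c *_) (g≗h w)
... | nothing = refl

⊙-zero : ∀ (t : Term n) e → (t ⊙ (λ _ → 0)) e ≡ 0
⊙-zero (c , v) e with e ∸ᵛ? v
... | just _ = *-zeroʳ c
... | nothing = refl

⊙-+ : ∀ (t : Term n) g h e → (t ⊙ (λ e′ → g e′ + h e′)) e ≡ (t ⊙ g) e + (t ⊙ h) e
⊙-+ (c , v) g h e with e ∸ᵛ? v
... | just w = *-distribˡ-+ c (g w) (h w)
... | nothing = refl

⊙-* : ∀ k (t : Term n) g e → (t ⊙ (λ e′ → k * g e′)) e ≡ k * (t ⊙ g) e
⊙-* k (c , v) g e with e ∸ᵛ? v
... | just w = x∙yz≈y∙xz c k (g w)
... | nothing = sym (*-zeroʳ k)

termCoeff-·ᵗ : ∀ (t s : Term n) e → termCoeff (t ·ᵗ s) e ≡ (t ⊙ termCoeff s) e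
termCoeff-·ᵗ (c , v) (d , w) e with e ∸ᵛ? v in e∸v
... | nothing = termCoeff-≢ (c * d) {zipWith _+_ v w} λ v+w≡e → case trans (sym e∸v) (∸ᵛ?-complete v+w≡e) of λ ()
... | just u with ≡-dec _≟_ w u
...   | yes refl = termCoeff-≡ (c * d) {zipWith _+_ v w} (∸ᵛ?-sound e∸v)
...   | no w≢u =
  trans (termCoeff-≢ (c * d) {zipWith _+_ v w} (w≢u ∘ sym ∘ just-injective ∘ trans (sym e∸v) ∘ ∸ᵛ?-complete))
        (sym (*-zeroʳ c))

coeff-map-·ᵗ : ∀ (t : Term n) q e → coeff (map (t ·ᵗ_) q) e ≡ (t ⊙ coeff q) e
coeff-map-·ᵗ t [] e = sym (⊙-zero t e)
coeff-map-·ᵗ t (s ∷ q) e = begin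
  coeff (t ·ᵗ s ∷ map (t ·ᵗ_) q) e                ≡⟨ coeff-∷ (t ·ᵗ s) (map (t ·ᵗ_) q) e ⟩
  termCoeff (t ·ᵗ s) e + coeff (map (t ·ᵗ_) q) e  ≡⟨ cong₂ _+_ (termCoeff-·ᵗ t s e) (coeff-map-·ᵗ t q e) ⟩
  (t ⊙ termCoeff s) e + (t ⊙ coeff q) e           ≡⟨ sym (⊙-+ t (termCoeff s) (coeff q) e) ⟩
  (t ⊙ (λ e′ → termCoeff s e′ + coeff q e′)) e    ≡⟨ ⊙-cong t (λ e′ → sym (coeff-∷ s q e′)) e ⟩
  (t ⊙ coeff (s ∷ q)) e ∎

coeff-*P : ∀ (p q : Poly n) e → coeff (p *P q) e ≡ (p ⊛ coeff q) e
coeff-*P [] q e = refl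
coeff-*P (t ∷ p) q e =
  trans (coeff-++ (map (t ·ᵗ_) q) (p *P q) e) (cong₂ _+_ (coeff-map-·ᵗ t q e) (coeff-*P p q e))

⊛-cong : ∀ (p : Poly n) {g h} → (∀ e → g e ≡ h e) → ∀ e → (p ⊛ g) e ≡ (p ⊛ h) e
⊛-cong [] g≗h e = refl
⊛-cong (t ∷ p) g≗h e = cong₂ _+_ (⊙-cong t g≗h e) (⊛-cong p g≗h e)

⊛-* : ∀ k (p : Poly n) g e → (p ⊛ (λ e′ → k * g e′)) e ≡ k * (p ⊛ g) e
⊛-* k [] g e = sym (*-zeroʳ k)
⊛-* k (t ∷ p) g e = trans (cong₂ _+_ (⊙-* k t g e) (⊛-* k p g e)) (sym (*-distribˡ-+ k _ _))

liftᵗ : Term n → Term (suc n)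
liftᵗ (c , v) = c , 0 ∷ v

⊙-liftᵗ : ∀ (t : Term n) g x e → (liftᵗ t ⊙ g) (x ∷ e) ≡ (t ⊙ (λ e′ → g (x ∷ e′))) e
⊙-liftᵗ (c , v) g x e with e ∸ᵛ? v
... | just _ = refl
... | nothing = refl

⊛-liftᵗ : ∀ (p : Poly n) g x e → (map liftᵗ p ⊛ g) (x ∷ e) ≡ (p ⊛ (λ e′ → g (x ∷ e′))) e
⊛-liftᵗ [] g x e = refl
⊛-liftᵗ (t ∷ p) g x e = cong₂ _+_ (⊙-liftᵗ t g x e) (⊛-liftᵗ p g x e)

varTerm : Fin n → Term n
varTerm i = 1 , tabulate (λ j → if ⌊ toℕ j ≟ toℕ i ⌋ then 1 else 0)

varTerm-suc : ∀ (i : Fin n) → varTerm (Fin.suc i) ≡ liftᵗ (varTerm i)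
varTerm-suc i = cong (λ v → 1 , 0 ∷ v) (tabulate-cong λ j → cong (λ b → if b then 1 else 0) (≟-suc (toℕ j) (toℕ i)))
  where
  ≟-suc : ∀ a b → ⌊ suc a ≟ suc b ⌋ ≡ ⌊ a ≟ b ⌋
  ≟-suc a b = trans (isYes≗does (suc a ≟ suc b)) (sym (isYes≗does (a ≟ b)))

-- The coefficient of x₁^z in x₁ · F, where f j is the coefficient of x₁^j in F.
atPred : ℕ → (ℕ → ℕ) → ℕ
atPred zero f = 0
atPred (suc z) f = f z

atPred-cong : ∀ z {f g : ℕ → ℕ} → (∀ x → f x ≡ g x) → atPred z f ≡ atPred z g
atPred-cong zero f≗g = refl
atPred-cong (suc z) f≗g = f≗g z

⊙-varTerm-zero : ∀ g z (r : Exponent n) → (varTerm Fin.zero ⊙ g) (z ∷ r) ≡ atPred z (λ z′ → g (z′ ∷ r))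
⊙-varTerm-zero g zero r = refl
⊙-varTerm-zero g (suc z) r rewrite ∸ᵛ?-zeros r = +-identityʳ (g (z ∷ r))

varsBelow : ℕ → List (Fin n) → Poly n
varsBelow k is = foldr (λ i acc → var i +P acc) [] (filter (λ i → toℕ i <? k) is)

varsBelow-zero : ∀ (is : List (Fin n)) → varsBelow 0 is ≡ []
varsBelow-zero [] = refl
varsBelow-zero (i ∷ is) = varsBelow-zero is

varsBelow-suc : ∀ k (is : List (Fin n)) → varsBelow (suc k) (map Fin.suc is) ≡ map liftᵗ (varsBelow k is)
varsBelow-suc k [] = refl
varsBelow-suc k (i ∷ is) with does (toℕ i <? k)
... | true = cong₂ _∷_ (varTerm-suc i) (varsBelow-suc k is)
... | false = varsBelow-suc k is

partialSum-zero : ∀ n → partialSum n 0 ≡ []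
partialSum-zero n = varsBelow-zero (allFin n)

partialSum-suc : ∀ n k → partialSum (suc n) (suc k) ≡ varTerm Fin.zero ∷ map liftᵗ (partialSum n k)
partialSum-suc n k = cong (varTerm Fin.zero ∷_)
  (trans (cong (varsBelow (suc k)) (sym (List.map-tabulate (λ i → i) Fin.suc))) (varsBelow-suc k (allFin n)))

⊛-partialSum-suc : ∀ n k g z (r : Exponent n) →
  (partialSum (suc n) (suc k) ⊛ g) (z ∷ r) ≡ atPred z (λ z′ → g (z′ ∷ r)) + (partialSum n k ⊛ (λ r′ → g (z ∷ r′))) r
⊛-partialSum-suc n k g z r = trans (cong (λ p → (p ⊛ g) (z ∷ r)) (partialSum-suc n k)) $
  cong₂ _+_ (⊙-varTerm-zero g z r) (⊛-liftᵗ (partialSum n k) g z r)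

bin : ℕ → ℕ → ℕ
bin x y = (x + y) C x

bin-zeroʳ : ∀ x → bin x 0 ≡ 1
bin-zeroʳ x rewrite +-identityʳ x = nCn≡1 x

bin-suc-suc : ∀ x y → bin (suc x) (suc y) ≡ bin x (suc y) + bin (suc x) y
bin-suc-suc x y = begin
  suc (x + suc y) C suc x                    ≡⟨ sym (nCk+nC[k+1]≡[n+1]C[k+1] (x + suc y) x) ⟩
  (x + suc y) C x + (x + suc y) C suc x      ≡⟨ cong (λ m → (x + suc y) C x + m C suc x) (+-suc x y) ⟩
  bin x (suc y) + bin (suc x) y ∎

bin-*-factorials : ∀ x y → bin x y * (x ! * y !) ≡ (x + y) !
bin-*-factorials x y = begin
  bin x y * (x ! * y !)                 ≡⟨ cong (λ m → bin x y * (x ! * m !)) (sym (m+n∸m≡n x y)) ⟩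
  bin x y * (x ! * (x + y ∸ x) !)       ≡⟨ trans (cong (_* (x ! * (x + y ∸ x) !)) (nCk≡n!/k![n-k]! x≤x+y))
                                                    (m/n*n≡m {{x !* (x + y ∸ x) !≢0}} (k![n∸k]!∣n! x≤x+y)) ⟩
  (x + y) ! ∎
  where x≤x+y = m≤m+n x y

atPred-binomial : ∀ x y (G : ℕ → ℕ) →
  atPred x (λ x′ → bin x′ y * G (x′ + y)) + atPred y (λ y′ → bin x y′ * G (x + y′)) ≡ bin x y * atPred (x + y) G
atPred-binomial zero zero G = refl
atPred-binomial zero (suc y) G = refl
atPred-binomial (suc x) zero G rewrite bin-zeroʳ x | bin-zeroʳ (suc x) = +-identityʳ _
atPred-binomial (suc x) (suc y) G = begin
  bin x (suc y) * G (x + suc y) + bin (suc x) y * G (suc (x + y))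
    ≡⟨ cong (λ m → bin x (suc y) * G (x + suc y) + bin (suc x) y * G m) (sym (+-suc x y)) ⟩
  bin x (suc y) * G (x + suc y) + bin (suc x) y * G (x + suc y)
    ≡⟨ sym (*-distribʳ-+ (G (x + suc y)) (bin x (suc y)) (bin (suc x) y)) ⟩
  (bin x (suc y) + bin (suc x) y) * G (x + suc y)
    ≡⟨ cong (_* G (x + suc y)) (sym (bin-suc-suc x y)) ⟩
  bin (suc x) (suc y) * G (x + suc y) ∎

-- Merges g h: the polynomial with coefficients g arises from the one with coefficients h by substituting
-- x₁ + x₂ for its first variable, coefficientwise by the binomial theorem.
Merges : ∀ {n} → (Exponent (2 + n) → ℕ) → (Exponent (1 + n) → ℕ) → Set
Merges g h = ∀ x y r → g (x ∷ y ∷ r) ≡ bin x y * h ((x + y) ∷ r)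

⊛-partialSum-merges : ∀ n k {g h} → Merges {n} g h →
  Merges (partialSum (2 + n) (2 + k) ⊛ g) (partialSum (1 + n) (1 + k) ⊛ h)
⊛-partialSum-merges n k {g} {h} g→h x y r = begin
  (partialSum (2 + n) (2 + k) ⊛ g) (x ∷ y ∷ r)
    ≡⟨ ⊛-partialSum-suc (suc n) (suc k) g x (y ∷ r) ⟩
  atPred x gˣ + (partialSum (suc n) (suc k) ⊛ (λ e → g (x ∷ e))) (y ∷ r)
    ≡⟨ cong (_+_ (atPred x gˣ)) (⊛-partialSum-suc n k (λ e → g (x ∷ e)) y r) ⟩
  atPred x gˣ + (atPred y gʸ + (partialSum n k ⊛ gʳ) r)
    ≡⟨ sym (+-assoc (atPred x gˣ) (atPred y gʸ) _) ⟩
  atPred x gˣ + atPred y gʸ + (partialSum n k ⊛ gʳ) r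
    ≡⟨ cong₂ _+_ (cong₂ _+_ (atPred-cong x λ x′ → g→h x′ y r) (atPred-cong y λ y′ → g→h x y′ r))
                 (⊛-cong (partialSum n k) (λ r′ → g→h x y r′) r) ⟩
  atPred x (λ x′ → bin x′ y * H (x′ + y)) + atPred y (λ y′ → bin x y′ * H (x + y′))
    + (partialSum n k ⊛ (λ r′ → bin x y * hʳ r′)) r
    ≡⟨ cong₂ _+_ (atPred-binomial x y H) (⊛-* (bin x y) (partialSum n k) hʳ r) ⟩
  bin x y * atPred (x + y) H + bin x y * (partialSum n k ⊛ hʳ) r
    ≡⟨ sym (*-distribˡ-+ (bin x y) _ _) ⟩
  bin x y * (atPred (x + y) H + (partialSum n k ⊛ hʳ) r)
    ≡⟨ cong (bin x y *_) (sym (⊛-partialSum-suc n k h (x + y) r)) ⟩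
  bin x y * (partialSum (suc n) (suc k) ⊛ h) ((x + y) ∷ r) ∎
  where
  gˣ = λ x′ → g (x′ ∷ y ∷ r)
  gʸ = λ y′ → g (x ∷ y′ ∷ r)
  gʳ = λ r′ → g (x ∷ y ∷ r′)
  H = λ z → h (z ∷ r)
  hʳ = λ r′ → h ((x + y) ∷ r′)

coeff-one : ∀ (e : Exponent n) → coeff one e ≡ termCoeff (1 , replicate n 0) e
coeff-one e = trans (coeff-∷ (1 , replicate _ 0) [] e) (+-identityʳ _)

one-merges : Merges {n} (coeff one) (coeff one)
one-merges {n} x y r = trans (coeff-one (x ∷ y ∷ r)) (trans (merge x y) (cong (bin x y *_) (sym (coeff-one ((x + y) ∷ r)))))
  where
  merge : ∀ x y →
    termCoeff (1 , replicate (2 + n) 0) (x ∷ y ∷ r) ≡ bin x y * termCoeff (1 , replicate (1 + n) 0) ((x + y) ∷ r)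
  merge zero zero = sym (*-identityˡ _)
  merge zero (suc y) = refl
  merge (suc x) y = sym (*-zeroʳ (bin (suc x) y))

partialSumProduct : ∀ n → List ℕ → Poly n
partialSumProduct n ks = foldr (λ k acc → partialSum n (suc k) *P acc) one ks

partialSumProduct-merges : ∀ n ks →
  Merges (coeff (partialSumProduct (2 + n) (map suc ks))) (coeff (partialSumProduct (1 + n) ks))
partialSumProduct-merges n [] = one-merges
partialSumProduct-merges n (k ∷ ks) x y r = begin
  coeff (partialSum (2 + n) (2 + k) *P P) (x ∷ y ∷ r)
    ≡⟨ coeff-*P (partialSum (2 + n) (2 + k)) P (x ∷ y ∷ r) ⟩
  (partialSum (2 + n) (2 + k) ⊛ coeff P) (x ∷ y ∷ r)
    ≡⟨ ⊛-partialSum-merges n k (partialSumProduct-merges n ks) x y r ⟩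
  bin x y * (partialSum (1 + n) (1 + k) ⊛ coeff Q) ((x + y) ∷ r)
    ≡⟨ cong (bin x y *_) (sym (coeff-*P (partialSum (1 + n) (1 + k)) Q ((x + y) ∷ r))) ⟩
  bin x y * coeff (partialSum (1 + n) (1 + k) *P Q) ((x + y) ∷ r) ∎
  where
  P = partialSumProduct (2 + n) (map suc ks)
  Q = partialSumProduct (1 + n) ks

coeff-x₁-*P : ∀ (q : Poly (suc n)) x r → coeff (partialSum (suc n) 1 *P q) (suc x ∷ r) ≡ coeff q (x ∷ r)
coeff-x₁-*P {n} q x r = begin
  coeff (partialSum (suc n) 1 *P q) (suc x ∷ r)
    ≡⟨ coeff-*P (partialSum (suc n) 1) q (suc x ∷ r) ⟩
  (partialSum (suc n) 1 ⊛ coeff q) (suc x ∷ r)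
    ≡⟨ ⊛-partialSum-suc n 0 (coeff q) (suc x) r ⟩
  coeff q (x ∷ r) + (partialSum n 0 ⊛ g) r
    ≡⟨ cong (λ p → coeff q (x ∷ r) + (p ⊛ g) r) (partialSum-zero n) ⟩
  coeff q (x ∷ r) + 0
    ≡⟨ +-identityʳ _ ⟩
  coeff q (x ∷ r) ∎
  where g = λ r′ → coeff q (suc x ∷ r′)

coeff-pPoly-merge : ∀ n x y (r : Exponent n) →
  coeff (pPoly (2 + n)) (suc x ∷ y ∷ r) ≡ bin x y * coeff (pPoly (1 + n)) ((x + y) ∷ r)
coeff-pPoly-merge n x y r = begin
  coeff (pPoly (2 + n)) (suc x ∷ y ∷ r)
    ≡⟨ coeff-x₁-*P (partialSumProduct (2 + n) (applyUpTo suc (1 + n))) x (y ∷ r) ⟩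
  coeff (partialSumProduct (2 + n) (applyUpTo suc (1 + n))) (x ∷ y ∷ r)
    ≡⟨ cong (λ ks → coeff (partialSumProduct (2 + n) ks) (x ∷ y ∷ r)) (sym (List.map-upTo suc (1 + n))) ⟩
  coeff (partialSumProduct (2 + n) (map suc (upTo (1 + n)))) (x ∷ y ∷ r)
    ≡⟨ partialSumProduct-merges n (upTo (1 + n)) x y r ⟩
  bin x y * coeff (pPoly (1 + n)) ((x + y) ∷ r) ∎

fraction-* : ∀ a b c d .{{_ : NonZero b}} .{{_ : NonZero d}} →
  (+ a / b) ℚ.* (+ c / d) ≡ (+ (a * c) / (b * d)) {{m*n≢0 b d}}
fraction-* a (suc b) c (suc d) = ℚ.toℚᵘ-injective
  (ℚᵘ.≃-trans (ℚ.toℚᵘ-homo-* (+ a / suc b) (+ c / suc d))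
  (ℚᵘ.≃-trans (ℚᵘ.*-cong (ℚ.toℚᵘ-fromℚᵘ (ℚᵘ.mkℚᵘ (+ a) b)) (ℚ.toℚᵘ-fromℚᵘ (ℚᵘ.mkℚᵘ (+ c) d)))
  (ℚᵘ.≃-trans (ℚᵘ.*≡* (cong (ℤ._* + suc (d + b * suc d)) (sym (ℤ.pos-* a c))))
              (ℚᵘ.≃-sym (ℚ.toℚᵘ-fromℚᵘ (ℚᵘ.mkℚᵘ (+ (a * c)) (d + b * suc d)))))))

fraction-≡ : ∀ a b c d .{{_ : NonZero b}} .{{_ : NonZero d}} → a * d ≡ c * b → + a / b ≡ + c / d
fraction-≡ a (suc b) c (suc d) eq = ℚ.fromℚᵘ-cong {ℚᵘ.mkℚᵘ (+ a) b} {ℚᵘ.mkℚᵘ (+ c) d}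
  (ℚᵘ.*≡* (trans (sym (ℤ.pos-* a (suc d))) (trans (cong +_ eq) (ℤ.pos-* c (suc b)))))

fraction-merge : ∀ a f g h b m .{{_ : NonZero a}} .{{_ : NonZero f}} .{{_ : NonZero g}} .{{_ : NonZero h}} →
  b * (f * g) ≡ h → (+ a / (a * f)) {{m*n≢0 a f}} ℚ.* (+ m / g) ≡ (+ b / 1) ℚ.* (+ m / h)
fraction-merge a f g h b m bfg≡h = begin
  (+ a / (a * f)) {{a*f≢0}} ℚ.* (+ m / g)   ≡⟨ fraction-* a (a * f) m g {{a*f≢0}} ⟩
  (+ (a * m) / (a * f * g)) {{a*f*g≢0}}     ≡⟨ fraction-≡ (a * m) (a * f * g) (b * m) (1 * h) {{a*f*g≢0}} {{1*h≢0}} cross ⟩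
  (+ (b * m) / (1 * h)) {{1*h≢0}}           ≡⟨ sym (fraction-* b 1 m h) ⟩
  (+ b / 1) ℚ.* (+ m / h) ∎
  where
  a*f≢0 = m*n≢0 a f
  a*f*g≢0 = m*n≢0 (a * f) g {{a*f≢0}}
  1*h≢0 = m*n≢0 1 h
  rearrange : ∀ a f g b m → a * m * (1 * (b * (f * g))) ≡ b * m * (a * f * g)
  rearrange = solve-∀
  cross : a * m * (1 * h) ≡ b * m * (a * f * g)
  cross = trans (cong (λ h → a * m * (1 * h)) (sym bfg≡h)) (rearrange a f g b m)

∏ : (ℕ → ℚ) → List ℕ → ℚ
∏ F ks = foldr (λ k acc → F k ℚ.* acc) ℚ.1ℚ ks

∏-applyUpTo-cong : ∀ F G f g m → (∀ j → F (f j) ≡ G (g j)) → ∏ F (applyUpTo f m) ≡ ∏ G (applyUpTo g m)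
∏-applyUpTo-cong F G f g zero Ff≗Gg = refl
∏-applyUpTo-cong F G f g (suc m) Ff≗Gg = cong₂ ℚ._*_ (Ff≗Gg 0) (∏-applyUpTo-cong F G (f ∘ suc) (g ∘ suc) m (Ff≗Gg ∘ suc))

prodFactors-merge : ∀ n x y (r : Vec ℕ (suc n)) → suc x + (y + sum (toList r)) ≡ 3 + n →
  prodFactors (3 + n) (suc x ∷ y ∷ r) ≡ (+ bin x y / 1) ℚ.* prodFactors (2 + n) ((x + y) ∷ r)
prodFactors-merge n x y r total = begin
  prodFactors (3 + n) a
    ≡⟨⟩
  factor (3 + n) a 1 ℚ.* (factor (3 + n) a 2 ℚ.* ∏ (factor (3 + n) a) (map suc (applyUpTo (suc ∘ suc) n)))
    ≡⟨ cong (λ p → factor (3 + n) a 1 ℚ.* (factor (3 + n) a 2 ℚ.* p)) tails ⟩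
  factor (3 + n) a 1 ℚ.* (factor (3 + n) a 2 ℚ.* rest)
    ≡⟨ sym (ℚ.*-assoc (factor (3 + n) a 1) _ rest) ⟩
  factor (3 + n) a 1 ℚ.* factor (3 + n) a 2 ℚ.* rest
    ≡⟨ cong (λ q → q ℚ.* factor (3 + n) a 2 ℚ.* rest) head ⟩
  (+ suc x / suc x !) {{suc x !≢0}} ℚ.* factor (3 + n) a 2 ℚ.* rest
    ≡⟨ cong (ℚ._* rest) (fraction-merge (suc x) (x !) (y !) ((x + y) !) (bin x y) m
                         {{_}} {{x !≢0}} {{y !≢0}} {{(x + y) !≢0}} (bin-*-factorials x y)) ⟩
  (+ bin x y / 1) ℚ.* factor (2 + n) b 1 ℚ.* rest
    ≡⟨ ℚ.*-assoc (+ bin x y / 1) (factor (2 + n) b 1) rest ⟩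
  (+ bin x y / 1) ℚ.* prodFactors (2 + n) b ∎
  where
  a = suc x ∷ y ∷ r
  b = (x + y) ∷ r
  rest = ∏ (factor (2 + n) b) (map suc (applyUpTo suc n))
  -- the numerator shared by the second factor of a and the first factor of b
  m = suc n + 1 ∸ sum (toList r)
  tails : ∏ (factor (3 + n) a) (map suc (applyUpTo (suc ∘ suc) n)) ≡ rest
  tails = begin
    ∏ (factor (3 + n) a) (map suc (applyUpTo (suc ∘ suc) n))
      ≡⟨ cong (∏ (factor (3 + n) a)) (List.map-applyUpTo (suc ∘ suc) suc n) ⟩
    ∏ (factor (3 + n) a) (applyUpTo (suc ∘ suc ∘ suc) n)
      ≡⟨ ∏-applyUpTo-cong (factor (3 + n) a) (factor (2 + n) b) (suc ∘ suc ∘ suc) (suc ∘ suc) n (λ _ → refl) ⟩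
    ∏ (factor (2 + n) b) (applyUpTo (suc ∘ suc) n)
      ≡⟨ cong (∏ (factor (2 + n) b)) (sym (List.map-applyUpTo suc suc n)) ⟩
    rest ∎
  head-numerator : 2 + n + 1 ∸ (y + sum (toList r)) ≡ suc x
  head-numerator = trans (cong (_∸ (y + sum (toList r))) (trans (+-comm (2 + n) 1) (sym total)))
                    (m+n∸n≡m (suc x) (y + sum (toList r)))
  head : factor (3 + n) a 1 ≡ (+ suc x / suc x !) {{suc x !≢0}}
  head = ℚ./-cong {{suc x !≢0}} {{suc x !≢0}} (cong +_ head-numerator) refl

InA-head≢0 : ∀ n (r : Vec ℕ (suc n)) → ¬ InA (2 + n) (0 ∷ r)
InA-head≢0 n r (tails , total) = 1+n≰n (subst (_≤ suc n) total (tails 1 (s≤s z≤n) (s≤s z≤n)))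

InA-merge : ∀ n x y (r : Vec ℕ (suc n)) → InA (3 + n) (suc x ∷ y ∷ r) → InA (2 + n) ((x + y) ∷ r)
InA-merge n x y r (tails , total) = tails′ , trans (+-assoc x y _) (suc-injective total)
  where
  tails′ : ∀ k → 1 ≤ k → k ≤ 1 + n → tailSum ((x + y) ∷ r) k ≤ 2 + n ∸ k
  tails′ (suc k) _ k<2+n = tails (2 + k) (s≤s z≤n) (s≤s k<2+n)

lemma2 : (n : ℕ) → (a : Vec ℕ n) → InA n a →
    (+ coeff (pPoly n) a) / 1 ≡ prodFactors n a
lemma2 0 [] _ = refl
lemma2 1 (x ∷ []) (_ , total) with trans (sym (+-identityʳ x)) total
... | refl = refl
lemma2 2 (x ∷ 0 ∷ []) (_ , total) with trans (sym (+-identityʳ x)) total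
... | refl = refl
lemma2 2 (x ∷ 1 ∷ []) (_ , total) with suc-injective (trans (+-comm 1 x) total)
... | refl = refl
lemma2 2 (x ∷ suc (suc y) ∷ []) (tails , _) with tails 1 (s≤s z≤n) (s≤s z≤n)
... | s≤s ()
lemma2 (suc (suc (suc n))) (0 ∷ r) h = ⊥-elim (InA-head≢0 (suc n) r h)
lemma2 (suc (suc (suc n))) (suc x ∷ y ∷ r) h@(_ , total) = begin
  + coeff (pPoly (3 + n)) a / 1
    ≡⟨ cong (λ c → + c / 1) (coeff-pPoly-merge (suc n) x y r) ⟩
  + (bin x y * coeff (pPoly (2 + n)) b) / 1
    ≡⟨ sym (fraction-* (bin x y) 1 (coeff (pPoly (2 + n)) b) 1) ⟩
  (+ bin x y / 1) ℚ.* (+ coeff (pPoly (2 + n)) b / 1)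
    ≡⟨ cong ((+ bin x y / 1) ℚ.*_) (lemma2 (suc (suc n)) b (InA-merge n x y r h)) ⟩
  (+ bin x y / 1) ℚ.* prodFactors (2 + n) b
    ≡⟨ sym (prodFactors-merge n x y r total) ⟩
  prodFactors (3 + n) a ∎
  where
  a = suc x ∷ y ∷ r
  b = (x + y) ∷ r
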